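{- Let $(D=(V,A),\mathcal F)$ be a digraft and let $z\in P(D,\mathcal F)\cap \mathbb Z^V$. Then: (1) there exists $J\subseteq A$ such that $|J\cap \delta(v)|-1=z_v$ for each $v\in V$; (2) for each $a\in A$, there exists $J\subseteq A$ such that $a\in J$ and $|J\cap \delta(v)|-1=z_v$ for each $v\in V$.
   Context: $\delta^+(W),\delta^-(W)$ are arcs leaving/entering $W$, $\delta(v)$ the arcs incident to $v$; $x(S)=\sum_{a\in S}x_a$. A dicut is $\delta^+(W)$ with $\emptyset\ne W\subsetneq V$, $\delta^-(W)=\emptyset$. $\mathrm{dij}(D)=\{x\ge0:x(\delta^+(W))\ge1$ for every dicut$\}$. A digraph is bipartite if every node is a source or a sink. A digraft is a pair $(D,\mathcal F)$ with $D=(V,A)$ bipartite with $2$-edge-connected underlying undirected graph, and $\mathcal F$ a family of subsets of $V$ with (a) $\emptyset,V\notin\mathcal F$, (b) $\delta^-(W)=\emptyset$ for $W\in\mathcal F$, (c) $V\setminus\{v\}\in\mathcal F$ for every sink $v$, (d) $F(D,\mathcal F):=\mathrm{dij}(D)\cap\{x:x(\delta^+(W))=1\ \forall W\in\mathcal F\}\neq\emptyset$. For $W\subseteq V$, $\mathrm{disc}(W)$ is the number of sinks in $W$ minus the number of sources in $W$. Let $\mathcal U=\{W:\emptyset\ne W\subsetneq V,\ \delta^-(W)=\emptyset\}$. $P(D)=\{z\in\mathbb R^V: z(W)\ge1+\mathrm{disc}(W)\ \forall W\in\mathcal U;\ z(V)=\mathrm{disc}(V)\}$, where $z(W)=\sum_{v\in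 W}z_v$, and $P(D,\mathcal F)=P(D)\cap\{z: z_v=0$ for every sink $v$; $z(W)=1+\mathrm{disc}(W)\ \forall W\in\mathcal F\}$.
   Formalization: In condition (d) of a digraft, $F(D,\mathcal F)$ is required to contain a point with rational coordinates. -}

module Defs where

open import Data.Nat as ℕ using (ℕ; zero; suc; _≡ᵇ_)
open import Data.Fin using (Fin; zero; suc; _≟_)
open import Data.Bool using (Bool; true; false; if_then_else_; _∧_; _∨_; not)
open import Data.Vec using (lookup)
open import Data.Fin.Subset using (Subset; ⁅_⁆; ∁) renaming (⊥ to ∅; ⊤ to Vall)
open import Data.Product using (_×_; ∃)
open import Relation.Nullary using (¬_)
open import Relation.Nullary.Decidable using (⌊_⌋)
open import Relation.Binary.PropositionalEquality using (_≡_; _≢_)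
open import Data.Integer as ℤ using (ℤ; +_)
open import Data.Rational as ℚ using (ℚ; 0ℚ; 1ℚ)
open import Function using (_∘_)

sumℚ : ∀ {k} → (Fin k → ℚ) → ℚ
sumℚ {zero}  f = 0ℚ
sumℚ {suc k} f = f zero ℚ.+ sumℚ (f ∘ suc)

sumℤ : ∀ {k} → (Fin k → ℤ) → ℤ
sumℤ {zero}  f = + 0
sumℤ {suc k} f = f zero ℤ.+ sumℤ (f ∘ suc)

count : ∀ {k} → (Fin k → Bool) → ℕ
count {zero}  f = 0
count {suc k} f = (if f zero then 1 else 0) ℕ.+ count (f ∘ suc)

record Digraph (n m : ℕ) : Set where
  field
    tail : Fin m → Fin n
    head : Fin m → Fin n
open Digraph public

module _ {n m : ℕ} (D : Digraph n m) where

  outdeg indeg : Fin n → ℕ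
  outdeg v = count (λ a → ⌊ tail D a ≟ v ⌋)
  indeg  v = count (λ a → ⌊ head D a ≟ v ⌋)

  sinkB sourceB : Fin n → Bool
  sinkB v   = outdeg v ≡ᵇ 0
  sourceB v = indeg v ≡ᵇ 0

  IsSink IsSource : Fin n → Set
  IsSink v   = sinkB v ≡ true
  IsSource v = sourceB v ≡ true

  Bipartite : Set
  Bipartite = ∀ v → (IsSource v) Data.Sum.⊎ (IsSink v)
    where import Data.Sum

  leaves enters : Subset n → Fin m → Bool
  leaves W a = lookup W (tail D a) ∧ not (lookup W (head D a))
  enters W a = lookup W (head D a) ∧ not (lookup W (tail D a))

  incident : Fin n → Fin m → Bool
  incident v a = ⌊ tail D a ≟ v ⌋ ∨ ⌊ head D a ≟ v ⌋

  TwoEdgeConnected : Set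
  TwoEdgeConnected = ∀ W → W ≢ ∅ → W ≢ Vall →
    2 ℕ.≤ count (λ a → leaves W a ∨ enters W a)

  NoEntering : Subset n → Set
  NoEntering W = ∀ a → enters W a ≡ false

  -- W ∈ 𝒰  (equivalently, δ⁺(W) is a dicut)
  InU : Subset n → Set
  InU W = (W ≢ ∅) × (W ≢ Vall) × NoEntering W

  xOut : (Fin m → ℚ) → Subset n → ℚ
  xOut x W = sumℚ (λ a → if leaves W a then x a else 0ℚ)

  InDij : (Fin m → ℚ) → Set
  InDij x = (∀ a → 0ℚ ℚ.≤ x a) × (∀ W → InU W → 1ℚ ℚ.≤ xOut x W)

  disc : Subset n → ℤ
  disc W = (+ count (λ v → lookup W v ∧ sinkB v)) ℤ.- (+ count (λ v → lookup W v ∧ sourceB v))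

  zSum : (Fin n → ℤ) → Subset n → ℤ
  zSum z W = sumℤ (λ v → if lookup W v then z v else + 0)

  InP : (Fin n → ℤ) → Set
  InP z = (∀ W → InU W → (+ 1) ℤ.+ disc W ℤ.≤ zSum z W) × (zSum z Vall ≡ disc Vall)

  record Digraft (𝓕 : Subset n → Set) : Set where
    field
      bipartite : Bipartite
      twoEC     : TwoEdgeConnected
      noEmpty   : ¬ 𝓕 ∅
      noFull    : ¬ 𝓕 Vall
      closed    : ∀ W → 𝓕 W → NoEntering W
      sinkCompl : ∀ v → IsSink v → 𝓕 (∁ ⁅ v ⁆)
      nonempty  : ∃ λ (x : Fin m → ℚ) → InDij x × (∀ W → 𝓕 W → xOut x W ≡ 1ℚ)

  InPF : (Subset n → Set) → (Fin n → ℤ) → Set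
  InPF 𝓕 z = InP z × (∀ v → IsSink v → z v ≡ + 0)
                   × (∀ W → 𝓕 W → zSum z W ≡ (+ 1) ℤ.+ disc W)

  DegreeCond : (Fin n → ℤ) → Subset m → Set
  DegreeCond z J = ∀ v → (+ count (λ a → lookup J a ∧ incident v a)) ℤ.- (+ 1) ≡ z v

-- Put c v = z v + 1 for a source v and c v = 0 for a sink. Every arc goes from a source
-- to a sink, so the required sets J are exactly the arc sets in which every sink has
-- in-degree 1 and every source v has out-degree c v: the perfect c-matchings of the sinks.
-- As z vanishes on sinks, z(W) + #sources(W) = c(W), so z(W) ≥ 1 + disc(W) reads
-- c(W) > #sinks(W). For W = {v}, v a source, this gives z v ≥ 0; for W = X ∪ N⁻(X), which
-- no arc enters, it is the strict Hall condition c(N⁻(X)) > |X| for every nonempty proper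
-- set X of sinks; and z(V) = disc(V) gives c(V) = #sinks. Hall's theorem for c-matchings
-- then yields J. It is proved by the Halmos–Vaughan induction: split at a tight set X
-- (c(N⁻(X)) = |X|) if there is one; otherwise take an arc into a sink whose tail has
-- positive capacity, delete its head and one unit of its tail's capacity. In the second
-- case any such arc may be taken, which gives (2). Only z ∈ P(D), z = 0 on sinks,
-- bipartiteness, 2-edge-connectivity (no node is both a source and a sink) and
-- V ∖ {v} ∈ 𝓕 for sinks v (no singleton is all of V) are used.

{-# OPTIONS --safe #-}
module Submission where

open import Defs
open import Algebra.Bundles using (CommutativeMonoid)
open import Data.Bool as Bool using (Bool; true; false; if_then_else_; _∧_; _∨_; not)
open import Data.Bool.Properties using (∨-identityʳ; ∨-zeroʳ; ∧-identityʳ; ∧-zeroʳ; T-≡)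
open import Data.Empty using (⊥-elim)
open import Data.Fin using (Fin; zero; suc; _≟_)
open import Data.Fin.Properties using (suc-injective; any?; all?)
open import Data.Fin.Subset using (Subset; ⁅_⁆; ∁; _∪_; _∩_) renaming (⊥ to ∅; ⊤ to Vall)
open import Data.Fin.Subset.Properties using (anySubset?)
open import Data.Integer as ℤ using (ℤ)
import Data.Integer.Properties as ℤ
open import Data.Integer.Tactic.RingSolver using (solve-∀)
open import Data.Nat as ℕ using (ℕ; zero; suc; _+_; _∸_; _≤_; _<_; z≤n; s≤s)
open import Data.Nat.Induction using (<-wellFounded)
import Data.Nat.Properties as ℕ
open import Data.Product using (_×_; ∃; _,_; proj₁; proj₂)
open import Data.Sum using (_⊎_; inj₁; inj₂)
open import Data.Vec using (lookup; tabulate)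
open import Data.Vec.Functional using (Vector)
open import Data.Vec.Properties using (lookup∘tabulate; lookup-map; lookup-replicate; lookup-zipWith; map-replicate)
open import Function using (_∘_; case_of_; Equivalence)
open import Induction.WellFounded using (Acc; acc)
open import Relation.Binary.PropositionalEquality
  using (_≡_; _≢_; refl; sym; trans; cong; cong₂; subst; subst₂; module ≡-Reasoning)
open import Relation.Nullary using (¬_; Dec; yes; no)
open import Relation.Nullary.Decidable
  using (⌊_⌋; ⌊⌋-map′; isYes≗does; dec-true; dec-false; _×-dec_; _→-dec_)

private
  variable
    k : ℕ
    A : Set

⌊⌋-true : (a? : Dec A) → ⌊ a? ⌋ ≡ true → A
⌊⌋-true (yes a) _ = a
⌊⌋-true (no _) ()

⌊⌋-intro : (a? : Dec A) → A → ⌊ a? ⌋ ≡ true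
⌊⌋-intro a? a = trans (isYes≗does a?) (dec-true a? a)

⌊⌋-false : (a? : Dec A) → ¬ A → ⌊ a? ⌋ ≡ false
⌊⌋-false a? ¬a = trans (isYes≗does a?) (dec-false a? ¬a)

𝟙 : Bool → ℕ
𝟙 b = if b then 1 else 0

-- Subsets are read through lookup, as in Defs, rather than through Data.Fin.Subset's _∈_.
infix 4 _⊆_

_⊆_ : Subset k → Subset k → Set
X ⊆ Y = ∀ i → lookup X i ≡ true → lookup Y i ≡ true

Disjoint : Subset k → Subset k → Set
Disjoint X Y = ∀ i → lookup X i ≡ true → lookup Y i ≡ false

NonEmpty : Subset k → Set
NonEmpty X = ∃ λ i → lookup X i ≡ true

lookup-∩∁ : (X Y : Subset k) (i : Fin k) → lookup (X ∩ ∁ Y) i ≡ lookup X i ∧ not (lookup Y i)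
lookup-∩∁ X Y i = trans (lookup-zipWith _∧_ i X (∁ Y)) (cong (lookup X i ∧_) (lookup-map i not Y))

∈∩∁-elim : (X Y : Subset k) (i : Fin k) → lookup (X ∩ ∁ Y) i ≡ true →
  lookup X i ≡ true × lookup Y i ≡ false
∈∩∁-elim X Y i i∈X∖Y rewrite lookup-∩∁ X Y i with lookup X i | lookup Y i
... | true | false = refl , refl

∈∩∁-intro : (X Y : Subset k) (i : Fin k) → lookup X i ≡ true → lookup Y i ≡ false →
  lookup (X ∩ ∁ Y) i ≡ true
∈∩∁-intro X Y i i∈X i∉Y rewrite lookup-∩∁ X Y i | i∈X | i∉Y = refl

∉∩∁ : (X Y : Subset k) (i : Fin k) → lookup Y i ≡ true → lookup (X ∩ ∁ Y) i ≡ false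
∉∩∁ X Y i i∈Y rewrite lookup-∩∁ X Y i | i∈Y = ∧-zeroʳ (lookup X i)

lookup-⁅⁆ : (i j : Fin k) → lookup ⁅ i ⁆ j ≡ ⌊ i ≟ j ⌋
lookup-⁅⁆ zero    zero    = refl
lookup-⁅⁆ zero    (suc j) = lookup-replicate j false
lookup-⁅⁆ (suc i) zero    = refl
lookup-⁅⁆ (suc i) (suc j) = trans (lookup-⁅⁆ i j) (sym (⌊⌋-map′ (cong suc) suc-injective (i ≟ j)))

∈⁅⁆⇒≡ : (i j : Fin k) → lookup ⁅ i ⁆ j ≡ true → i ≡ j
∈⁅⁆⇒≡ i j j∈⁅i⁆ = ⌊⌋-true (i ≟ j) (trans (sym (lookup-⁅⁆ i j)) j∈⁅i⁆)

i∈⁅i⁆ : (i : Fin k) → lookup ⁅ i ⁆ i ≡ true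
i∈⁅i⁆ i = trans (lookup-⁅⁆ i i) (⌊⌋-intro (i ≟ i) refl)

∉∅ : (i : Fin k) → lookup ∅ i ≡ false
∉∅ i = lookup-replicate i false

∉⁅⁆ : {i j : Fin k} → i ≢ j → lookup ⁅ i ⁆ j ≡ false
∉⁅⁆ {i = i} {j} i≢j = trans (lookup-⁅⁆ i j) (⌊⌋-false (i ≟ j) i≢j)

⁅⁆≢∅ : (i : Fin k) → ⁅ i ⁆ ≢ ∅
⁅⁆≢∅ i ⁅i⁆≡∅ = case trans (sym (i∈⁅i⁆ i)) (trans (cong (λ X → lookup X i) ⁅i⁆≡∅) (∉∅ i)) of λ ()

⁅⁆⊆ : (X : Subset k) (i : Fin k) → lookup X i ≡ true → ⁅ i ⁆ ⊆ X
⁅⁆⊆ X i i∈X j j∈⁅i⁆ with refl ← ∈⁅⁆⇒≡ i j j∈⁅i⁆ = i∈X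

i∈X∪⁅i⁆ : (X : Subset k) (i : Fin k) → lookup (X ∪ ⁅ i ⁆) i ≡ true
i∈X∪⁅i⁆ X i = trans (lookup-zipWith _∨_ i X ⁅ i ⁆) (trans (cong (lookup X i ∨_) (i∈⁅i⁆ i)) (∨-zeroʳ _))

-- Sums over subsets

module RestrictedSum {a ℓ} (M : CommutativeMonoid a ℓ) where

  open CommutativeMonoid M
    using (_≈_; _∙_; setoid; reflexive; identityˡ; identityʳ; ∙-congˡ)
    renaming (Carrier to C; ε to 0#; refl to ≈-refl; sym to ≈-sym)
  open import Algebra.Properties.CommutativeMonoid.Sum M public
    using (sum; sum-cong-≋; sum-cong-≗; ∑-distrib-+)
  open import Algebra.Properties.CommutativeMonoid.Sum M using (sum-replicate-zero)
  open import Relation.Binary.Reasoning.Setoid setoid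

  restrict : Subset k → Vector C k → Vector C k
  restrict X f i = if lookup X i then f i else 0#

  sum-restrict-0 : (X : Subset k) {f : Vector C k} →
    (∀ i → lookup X i ≡ true → f i ≈ 0#) → sum (restrict X f) ≈ 0#
  sum-restrict-0 {k} X {f} f≈0 = begin
    sum (restrict X f)      ≈⟨ sum-cong-≋ pointwise ⟩
    sum {k} (λ _ → 0#)      ≈⟨ sum-replicate-zero k ⟩
    0#                      ∎
    where
    pointwise : ∀ i → restrict X f i ≈ 0#
    pointwise i with lookup X i in i∈X
    ... | true  = f≈0 i i∈X
    ... | false = ≈-refl

  sum-restrict-cong : (X : Subset k) {f g : Vector C k} →
    (∀ i → lookup X i ≡ true → f i ≈ g i) → sum (restrict X f) ≈ sum (restrict X g)
  sum-restrict-cong X {f} {g} f≈g = sum-cong-≋ pointwise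
    where
    pointwise : ∀ i → restrict X f i ≈ restrict X g i
    pointwise i with lookup X i in i∈X
    ... | true  = f≈g i i∈X
    ... | false = ≈-refl

  sum-partition : (X Y Z : Subset k) {f : Vector C k} →
    (∀ i → lookup X i ≡ lookup Y i ∨ lookup Z i) → Disjoint Y Z →
    sum (restrict X f) ≈ sum (restrict Y f) ∙ sum (restrict Z f)
  sum-partition X Y Z {f} X≡Y∪Z Y∩Z≡∅ = begin
    sum (restrict X f)                            ≈⟨ sum-cong-≋ pointwise ⟩
    sum (λ i → restrict Y f i ∙ restrict Z f i)   ≈⟨ ∑-distrib-+ (restrict Y f) (restrict Z f) ⟩
    sum (restrict Y f) ∙ sum (restrict Z f)       ∎
    where
    pointwise : ∀ i → restrict X f i ≈ restrict Y f i ∙ restrict Z f i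
    pointwise i rewrite X≡Y∪Z i with lookup Y i in i∈Y
    ... | false = ≈-sym (identityˡ _)
    ... | true rewrite Y∩Z≡∅ i i∈Y = ≈-sym (identityʳ _)

  sum-restrict-∪ : (Y Z : Subset k) {f : Vector C k} → Disjoint Y Z →
    sum (restrict (Y ∪ Z) f) ≈ sum (restrict Y f) ∙ sum (restrict Z f)
  sum-restrict-∪ Y Z = sum-partition (Y ∪ Z) Y Z (λ i → lookup-zipWith _∨_ i Y Z)

  sum-restrict-∩∁ : (T X : Subset k) {f : Vector C k} → X ⊆ T →
    sum (restrict T f) ≈ sum (restrict (T ∩ ∁ X) f) ∙ sum (restrict X f)
  sum-restrict-∩∁ T X X⊆T = sum-partition T (T ∩ ∁ X) X T≡T∖X∪X T∖X∩X≡∅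
    where
    T≡T∖X∪X : ∀ i → lookup T i ≡ lookup (T ∩ ∁ X) i ∨ lookup X i
    T≡T∖X∪X i rewrite lookup-∩∁ T X i with lookup X i in i∈X
    ... | true  rewrite X⊆T i i∈X = refl
    ... | false = sym (trans (∨-identityʳ _) (∧-identityʳ _))
    T∖X∩X≡∅ : Disjoint (T ∩ ∁ X) X
    T∖X∩X≡∅ i i∈T∖X = proj₂ (∈∩∁-elim T X i i∈T∖X)

  sum-restrict-Vall : (f : Vector C k) → sum (restrict Vall f) ≈ sum f
  sum-restrict-Vall f = reflexive (sum-cong-≗ λ i → cong (if_then f i else 0#) (lookup-replicate i true))

  sum-restrict-⁅⁆ : (i : Fin k) {f : Vector C k} → sum (restrict ⁅ i ⁆ f) ≈ f i
  sum-restrict-⁅⁆ {suc k} zero {f} = begin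
    f zero ∙ sum (restrict ∅ (f ∘ suc))   ≈⟨ ∙-congˡ (sum-restrict-0 ∅ ∅-empty) ⟩
    f zero ∙ 0#                           ≈⟨ identityʳ _ ⟩
    f zero                                ∎
    where
    ∅-empty : ∀ j → lookup (∅ {k}) j ≡ true → f (suc j) ≈ 0#
    ∅-empty j j∈∅ = case trans (sym j∈∅) (∉∅ j) of λ ()
  sum-restrict-⁅⁆ (suc i) {f} = begin
    0# ∙ sum (restrict ⁅ i ⁆ (f ∘ suc))   ≈⟨ identityˡ _ ⟩
    sum (restrict ⁅ i ⁆ (f ∘ suc))        ≈⟨ sum-restrict-⁅⁆ i ⟩
    f (suc i)                             ∎

module ℕΣ = RestrictedSum ℕ.+-0-commutativeMonoid
module ℤΣ = RestrictedSum ℤ.+-0-commutativeMonoid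
open ℕΣ

size : Subset k → ℕ
size X = sum (restrict X (λ _ → 1))

≤-sum : (f : Vector ℕ k) (i : Fin k) → f i ≤ sum f
≤-sum f zero    = ℕ.m≤m+n (f zero) _
≤-sum f (suc i) = ℕ.≤-trans (≤-sum (f ∘ suc) i) (ℕ.m≤n+m _ (f zero))

sum-mono-≤ : {f g : Vector ℕ k} → (∀ i → f i ≤ g i) → sum f ≤ sum g
sum-mono-≤ {zero}  _   = z≤n
sum-mono-≤ {suc k} f≤g = ℕ.+-mono-≤ (f≤g zero) (sum-mono-≤ (f≤g ∘ suc))

sum-positive : (f : Vector ℕ k) → 0 < sum f → ∃ λ i → 0 < f i
sum-positive {suc k} f 0<Σf with f zero in f₀≡
... | suc _ = zero , subst (0 <_) (sym f₀≡) (s≤s z≤n)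
... | zero  = let i , 0<fi = sum-positive (f ∘ suc) 0<Σf in suc i , 0<fi

size-positive : (X : Subset k) (i : Fin k) → lookup X i ≡ true → 0 < size X
size-positive X i i∈X = ℕ.≤-trans (ℕ.≤-reflexive (cong 𝟙 (sym i∈X))) (≤-sum (restrict X (λ _ → 1)) i)

size-empty : (X : Subset k) → ¬ NonEmpty X → size X ≡ 0
size-empty X X≡∅ = sum-restrict-0 X λ i i∈X → ⊥-elim (X≡∅ (i , i∈X))

size-remove : (X : Subset k) (i : Fin k) → lookup X i ≡ true → size X ≡ size (X ∩ ∁ ⁅ i ⁆) + 1
size-remove X i i∈X = trans (sum-restrict-∩∁ X ⁅ i ⁆ (⁅⁆⊆ X i i∈X)) (cong (size (X ∩ ∁ ⁅ i ⁆) +_) (sum-restrict-⁅⁆ i))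

sum-𝟙≟ : (i : Fin k) → sum (λ j → 𝟙 ⌊ i ≟ j ⌋) ≡ 1
sum-𝟙≟ i = trans (sum-cong-≗ λ j → cong 𝟙 (sym (lookup-⁅⁆ i j))) (sum-restrict-⁅⁆ i)

decrement : Fin k → Vector ℕ k → Vector ℕ k
decrement i f j = f j ∸ 𝟙 ⌊ i ≟ j ⌋

decrement-+ : (f : Vector ℕ k) (i : Fin k) → 0 < f i → ∀ j → f j ≡ decrement i f j + 𝟙 ⌊ i ≟ j ⌋
decrement-+ f i 0<fᵢ j with i ≟ j
... | yes refl = sym (ℕ.m∸n+n≡m 0<fᵢ)
... | no _     = sym (ℕ.+-identityʳ (f j))

sum-decrement : (f : Vector ℕ k) (i : Fin k) → 0 < f i → sum f ≡ sum (decrement i f) + 1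
sum-decrement f i 0<fᵢ = begin
  sum f                                        ≡⟨ sum-cong-≗ (decrement-+ f i 0<fᵢ) ⟩
  sum (λ j → decrement i f j + 𝟙 ⌊ i ≟ j ⌋)    ≡⟨ ∑-distrib-+ (decrement i f) (λ j → 𝟙 ⌊ i ≟ j ⌋) ⟩
  sum (decrement i f) + sum (λ j → 𝟙 ⌊ i ≟ j ⌋) ≡⟨ cong (sum (decrement i f) +_) (sum-𝟙≟ i) ⟩
  sum (decrement i f) + 1                      ∎
  where open ≡-Reasoning

sum-restrict-mono : (X Y : Subset k) {f : Vector ℕ k} → X ⊆ Y → sum (restrict X f) ≤ sum (restrict Y f)
sum-restrict-mono X Y {f} X⊆Y = sum-mono-≤ pointwise
  where
  pointwise : ∀ i → restrict X f i ≤ restrict Y f i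
  pointwise i with lookup X i in i∈X
  ... | false = z≤n
  ... | true rewrite X⊆Y i i∈X = ℕ.≤-refl

count≡sum : (p : Fin k → Bool) → count p ≡ sum (𝟙 ∘ p)
count≡sum {zero}  p = refl
count≡sum {suc k} p = cong (_+_ (𝟙 (p zero))) (count≡sum (p ∘ suc))

count-∧ : (X : Subset k) (p : Fin k → Bool) → count (λ i → lookup X i ∧ p i) ≡ sum (restrict X (𝟙 ∘ p))
count-∧ X p = trans (count≡sum (λ i → lookup X i ∧ p i)) (sum-cong-≗ pointwise)
  where
  pointwise : ∀ i → 𝟙 (lookup X i ∧ p i) ≡ restrict X (𝟙 ∘ p) i
  pointwise i with lookup X i
  ... | true  = refl
  ... | false = refl

count-positive : (p : Fin k → Bool) (i : Fin k) → p i ≡ true → 0 < count p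
count-positive p i pᵢ = ℕ.≤-trans (ℕ.≤-reflexive (cong 𝟙 (sym pᵢ)))
  (ℕ.≤-trans (≤-sum (𝟙 ∘ p) i) (ℕ.≤-reflexive (sym (count≡sum p))))

count≡0⇒false : (p : Fin k → Bool) → count p ≡ 0 → ∀ i → p i ≡ false
count≡0⇒false p count≡0 i with p i in pᵢ
... | false = refl
... | true with () ← subst (0 <_) count≡0 (count-positive p i pᵢ)

count-positive⇒∃ : (p : Fin k → Bool) → 0 < count p → ∃ λ i → p i ≡ true
count-positive⇒∃ p 0<count with sum-positive (𝟙 ∘ p) (subst (0 <_) (count≡sum p) 0<count)
... | i , 0<𝟙pᵢ with p i in pᵢ
...   | true = i , pᵢ

count-false : (p : Fin k → Bool) → (∀ i → p i ≡ false) → count p ≡ 0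
count-false {zero}  p p≡false = refl
count-false {suc k} p p≡false rewrite p≡false zero = count-false (p ∘ suc) (p≡false ∘ suc)

count-⁅⁆ : (i : Fin k) (p : Fin k → Bool) → count (λ j → lookup ⁅ i ⁆ j ∧ p j) ≡ 𝟙 (p i)
count-⁅⁆ i p = trans (count-∧ ⁅ i ⁆ p) (sum-restrict-⁅⁆ i)

-- Hall's theorem for perfect c-matchings

module HallTheorem {n m : ℕ} (D : Digraph n m) where

  N⁻ : Subset n → Subset n
  N⁻ X = tabulate λ u → ⌊ any? (λ a → tail D a ≟ u ×-dec lookup X (head D a) Bool.≟ true) ⌋

  N⁻-intro : ∀ X a → lookup X (head D a) ≡ true → lookup (N⁻ X) (tail D a) ≡ true
  N⁻-intro X a a∈X = trans (lookup∘tabulate _ (tail D a)) (⌊⌋-intro (any? _) (a , refl , a∈X))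

  N⁻-elim : ∀ X u → lookup (N⁻ X) u ≡ true → ∃ λ a → tail D a ≡ u × lookup X (head D a) ≡ true
  N⁻-elim X u u∈N⁻X = ⌊⌋-true (any? _) (trans (sym (lookup∘tabulate _ u)) u∈N⁻X)

  N⁻-mono : ∀ X Y → X ⊆ Y → N⁻ X ⊆ N⁻ Y
  N⁻-mono X Y X⊆Y u u∈N⁻X with N⁻-elim X u u∈N⁻X
  ... | a , refl , a∈X = N⁻-intro Y a (X⊆Y (head D a) a∈X)

  N⁻-∪ : ∀ X Y u → lookup (N⁻ (X ∪ Y)) u ≡ true → lookup (N⁻ Y) u ≡ false → lookup (N⁻ X) u ≡ true
  N⁻-∪ X Y u u∈N⁻X∪Y u∉N⁻Y with N⁻-elim (X ∪ Y) u u∈N⁻X∪Y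
  ... | a , refl , a∈X∪Y
    with lookup X (head D a) in a∈X | lookup Y (head D a) in a∈Y
       | trans (sym (lookup-zipWith _∨_ (head D a) X Y)) a∈X∪Y
  ... | true  | _     | _ = N⁻-intro X a a∈X
  ... | false | true  | _ with () ← trans (sym (N⁻-intro Y a a∈Y)) u∉N⁻Y
  ... | false | false | ()

  cap : Vector ℕ n → Subset n → ℕ
  cap c X = sum (restrict (N⁻ X) c)

  HallCondition : Subset n → Vector ℕ n → Set
  HallCondition T c = ∀ X → X ⊆ T → size X ≤ cap c X

  StrictHallCondition : Subset n → Vector ℕ n → Set
  StrictHallCondition T c = ∀ X → X ⊆ T → NonEmpty X → NonEmpty (T ∩ ∁ X) → size X < cap c X

  Tight : Subset n → Vector ℕ n → Subset n → Set
  Tight T c X = X ⊆ T × NonEmpty X × NonEmpty (T ∩ ∁ X) × cap c X ≤ size X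

  indegIn outdegIn : Subset m → Fin n → ℕ
  indegIn  J w = sum (restrict J λ a → 𝟙 ⌊ head D a ≟ w ⌋)
  outdegIn J u = sum (restrict J λ a → 𝟙 ⌊ tail D a ≟ u ⌋)

  record PerfectMatching (T : Subset n) (c : Vector ℕ n) (J : Subset m) : Set where
    field
      head∈T      : ∀ a → lookup J a ≡ true → lookup T (head D a) ≡ true
      indegIn≡1   : ∀ w → lookup T w ≡ true → indegIn J w ≡ 1
      outdegIn≡c  : ∀ u → outdegIn J u ≡ c u

  Solvable : Subset n → Set
  Solvable T = ∀ c → HallCondition T c → sum c ≡ size T → ∃ (PerfectMatching T c)

  nonEmpty? : (X : Subset n) → Dec (NonEmpty X)
  nonEmpty? X = any? λ i → lookup X i Bool.≟ true

  _⊆?_ : (X Y : Subset n) → Dec (X ⊆ Y)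
  X ⊆? Y = all? λ i → (lookup X i Bool.≟ true) →-dec (lookup Y i Bool.≟ true)

  strict-or-tight : ∀ T c → StrictHallCondition T c ⊎ ∃ (Tight T c)
  strict-or-tight T c
    with anySubset? (λ X → X ⊆? T ×-dec nonEmpty? X ×-dec nonEmpty? (T ∩ ∁ X) ×-dec cap c X ℕ.≤? size X)
  ... | yes tight = inj₂ tight
  ... | no ¬tight = inj₁ λ X X⊆T X≢∅ T⊈X → ℕ.≰⇒> λ cap≤size → ¬tight (X , X⊆T , X≢∅ , T⊈X , cap≤size)

  strict⇒hall : ∀ T c → StrictHallCondition T c → size T ≤ cap c T → HallCondition T c
  strict⇒hall T c strict size≤cap X X⊆T with nonEmpty? X | nonEmpty? (T ∩ ∁ X)
  ... | no X≡∅ | _ = ℕ.≤-trans (ℕ.≤-reflexive (size-empty X X≡∅)) z≤n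
  ... | yes X≢∅ | yes T⊈X = ℕ.<⇒≤ (strict X X⊆T X≢∅ T⊈X)
  ... | yes _ | no T⊆X = begin
    size X   ≤⟨ sum-restrict-mono X T X⊆T ⟩
    size T   ≤⟨ size≤cap ⟩
    cap c T  ≤⟨ sum-restrict-mono (N⁻ T) (N⁻ X) (N⁻-mono T X T⊆X') ⟩
    cap c X  ∎
    where
    open ℕ.≤-Reasoning
    T⊆X' : T ⊆ X
    T⊆X' i i∈T with lookup X i in i∈X
    ... | true = refl
    ... | false = ⊥-elim (T⊆X (i , ∈∩∁-intro T X i i∈T i∈X))

  indegIn-outside : ∀ {S c J} w → PerfectMatching S c J → lookup S w ≡ false → indegIn J w ≡ 0
  indegIn-outside {S} {J = J} w M w∉S = sum-restrict-0 J λ a a∈J →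
    cong 𝟙 (⌊⌋-false (head D a ≟ w) λ { refl → case trans (sym (head∈T a a∈J)) w∉S of λ () })
    where open PerfectMatching M

  empty-matching : ∀ T c → ¬ NonEmpty T → sum c ≡ size T → PerfectMatching T c ∅
  empty-matching T c T≡∅ Σc≡size = record
    { head∈T     = λ a a∈∅ → case trans (sym a∈∅) (∉∅ a) of λ ()
    ; indegIn≡1  = λ w w∈T → ⊥-elim (T≡∅ (w , w∈T))
    ; outdegIn≡c = λ u → trans (sum-restrict-0 (∅ {m}) λ a a∈∅ → case trans (sym a∈∅) (∉∅ a) of λ ())
                               (sym (ℕ.n≤0⇒n≡0 (ℕ.≤-trans (≤-sum c u) (ℕ.≤-reflexive (trans Σc≡size (size-empty T T≡∅))))))
    }

  matching-∪ : ∀ T X c₁ c₂ c J₁ J₂ → X ⊆ T → (∀ u → c u ≡ c₁ u + c₂ u) →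
    PerfectMatching X c₁ J₁ → PerfectMatching (T ∩ ∁ X) c₂ J₂ → PerfectMatching T c (J₁ ∪ J₂)
  matching-∪ T X c₁ c₂ c J₁ J₂ X⊆T c≡c₁+c₂ M₁ M₂ = record
    { head∈T = head∈T
    ; indegIn≡1 = indegIn≡1
    ; outdegIn≡c = λ u → trans (sum-restrict-∪ J₁ J₂ J₁∩J₂≡∅)
        (trans (cong₂ _+_ (M₁.outdegIn≡c u) (M₂.outdegIn≡c u)) (sym (c≡c₁+c₂ u)))
    }
    where
    module M₁ = PerfectMatching M₁
    module M₂ = PerfectMatching M₂
    J₁∩J₂≡∅ : Disjoint J₁ J₂
    J₁∩J₂≡∅ a a∈J₁ with lookup J₂ a in a∈J₂
    ... | false = refl
    ... | true = case trans (sym (M₁.head∈T a a∈J₁)) (proj₂ (∈∩∁-elim T X _ (M₂.head∈T a a∈J₂))) of λ ()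
    head∈T : ∀ a → lookup (J₁ ∪ J₂) a ≡ true → lookup T (head D a) ≡ true
    head∈T a a∈J rewrite lookup-zipWith _∨_ a J₁ J₂ with lookup J₁ a in a∈J₁
    ... | true  = X⊆T _ (M₁.head∈T a a∈J₁)
    ... | false = proj₁ (∈∩∁-elim T X _ (M₂.head∈T a a∈J))
    indegIn≡1 : ∀ w → lookup T w ≡ true → indegIn (J₁ ∪ J₂) w ≡ 1
    indegIn≡1 w w∈T with lookup X w in w∈X
    ... | true  = trans (sum-restrict-∪ J₁ J₂ J₁∩J₂≡∅) (cong₂ _+_ (M₁.indegIn≡1 w w∈X)
                    (indegIn-outside w M₂ (∉∩∁ T X w w∈X)))
    ... | false = trans (sum-restrict-∪ J₁ J₂ J₁∩J₂≡∅) (cong₂ _+_ (indegIn-outside w M₁ w∈X)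
                    (M₂.indegIn≡1 w (∈∩∁-intro T X w w∈T w∈X)))

  SolvableBelow : Subset n → Set
  SolvableBelow T = ∀ T' → size T' < size T → Solvable T'

  onN⁻ offN⁻ : Subset n → Vector ℕ n → Vector ℕ n
  onN⁻  X c = restrict (N⁻ X) c
  offN⁻ X c u = if lookup (N⁻ X) u then 0 else c u

  onN⁻+offN⁻ : ∀ X c u → c u ≡ onN⁻ X c u + offN⁻ X c u
  onN⁻+offN⁻ X c u with lookup (N⁻ X) u
  ... | true  = sym (ℕ.+-identityʳ (c u))
  ... | false = refl

  hall-onN⁻ : ∀ T c X → HallCondition T c → X ⊆ T → HallCondition X (onN⁻ X c)
  hall-onN⁻ T c X hall X⊆T Y Y⊆X =
    subst (size Y ≤_) (sum-restrict-cong (N⁻ Y) c≡onN⁻) (hall Y λ i → X⊆T i ∘ Y⊆X i)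
    where
    c≡onN⁻ : ∀ u → lookup (N⁻ Y) u ≡ true → c u ≡ onN⁻ X c u
    c≡onN⁻ u u∈N⁻Y rewrite N⁻-mono Y X Y⊆X u u∈N⁻Y = refl

  hall-offN⁻ : ∀ T c X → HallCondition T c → X ⊆ T → cap c X ≡ size X → HallCondition (T ∩ ∁ X) (offN⁻ X c)
  hall-offN⁻ T c X hall X⊆T cap≡size Y Y⊆T∖X = ℕ.+-cancelʳ-≤ (size X) (size Y) (cap (offN⁻ X c) Y) (begin
    size Y + size X                                      ≡⟨ sum-restrict-∪ Y X Y∩X≡∅ ⟨
    size (Y ∪ X)                                         ≤⟨ hall (Y ∪ X) Y∪X⊆T ⟩
    cap c (Y ∪ X)                                        ≤⟨ sum-mono-≤ cap-∪ ⟩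
    sum (λ u → restrict (N⁻ Y) (offN⁻ X c) u + onN⁻ X c u) ≡⟨ ∑-distrib-+ (restrict (N⁻ Y) (offN⁻ X c)) (onN⁻ X c) ⟩
    cap (offN⁻ X c) Y + cap c X                          ≡⟨ cong (cap (offN⁻ X c) Y +_) cap≡size ⟩
    cap (offN⁻ X c) Y + size X                           ∎)
    where
    open ℕ.≤-Reasoning
    Y∩X≡∅ : Disjoint Y X
    Y∩X≡∅ i i∈Y = proj₂ (∈∩∁-elim T X i (Y⊆T∖X i i∈Y))
    Y∪X⊆T : Y ∪ X ⊆ T
    Y∪X⊆T i i∈Y∪X rewrite lookup-zipWith _∨_ i Y X with lookup Y i in i∈Y
    ... | true  = proj₁ (∈∩∁-elim T X i (Y⊆T∖X i i∈Y))
    ... | false = X⊆T i i∈Y∪X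
    cap-∪ : ∀ u → restrict (N⁻ (Y ∪ X)) c u ≤ restrict (N⁻ Y) (offN⁻ X c) u + onN⁻ X c u
    cap-∪ u with lookup (N⁻ X) u in u∈N⁻X | lookup (N⁻ (Y ∪ X)) u in u∈N⁻Y∪X
    ... | true  | true  = ℕ.m≤n+m (c u) _
    ... | _     | false = z≤n
    ... | false | true  rewrite N⁻-∪ Y X u u∈N⁻Y∪X u∈N⁻X = ℕ.m≤m+n (c u) 0

  split-at-tight : ∀ T c X → SolvableBelow T → Tight T c X →
    HallCondition T c → sum c ≡ size T → ∃ (PerfectMatching T c)
  split-at-tight T c X solvable< (X⊆T , (x , x∈X) , (y , y∈T∖X) , cap≤size) hall Σc≡size =
    let J₁ , M₁ = solvable< X size-X<size-T (onN⁻ X c) (hall-onN⁻ T c X hall X⊆T) cap≡size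
        J₂ , M₂ = solvable< T∖X size-T∖X<size-T (offN⁻ X c) (hall-offN⁻ T c X hall X⊆T cap≡size) Σoff
    in  J₁ ∪ J₂ , matching-∪ T X (onN⁻ X c) (offN⁻ X c) c J₁ J₂ X⊆T (onN⁻+offN⁻ X c) M₁ M₂
    where
    T∖X = T ∩ ∁ X
    size-T : size T ≡ size T∖X + size X
    size-T = sum-restrict-∩∁ T X X⊆T
    size-X<size-T : size X < size T
    size-X<size-T = subst (size X <_) (sym size-T) (ℕ.m<n+m (size X) (size-positive T∖X y y∈T∖X))
    size-T∖X<size-T : size T∖X < size T
    size-T∖X<size-T = subst (size T∖X <_) (sym size-T) (ℕ.m<m+n (size T∖X) (size-positive X x x∈X))
    cap≡size : cap c X ≡ size X
    cap≡size = ℕ.≤-antisym cap≤size (hall X X⊆T)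
    Σoff : sum (offN⁻ X c) ≡ size T∖X
    Σoff = ℕ.+-cancelˡ-≡ (size X) (sum (offN⁻ X c)) (size T∖X) (begin
      size X + sum (offN⁻ X c)                    ≡⟨ cong (_+ sum (offN⁻ X c)) cap≡size ⟨
      sum (onN⁻ X c) + sum (offN⁻ X c)            ≡⟨ ∑-distrib-+ (onN⁻ X c) (offN⁻ X c) ⟨
      sum (λ u → onN⁻ X c u + offN⁻ X c u)        ≡⟨ sum-cong-≗ (onN⁻+offN⁻ X c) ⟨
      sum c                                       ≡⟨ Σc≡size ⟩
      size T                                      ≡⟨ trans size-T (ℕ.+-comm (size T∖X) (size X)) ⟩
      size X + size T∖X                           ∎)
      where open ≡-Reasoning

  matching-+arc : ∀ T c c' J a → lookup T (head D a) ≡ true →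
    (∀ v → c v ≡ c' v + 𝟙 ⌊ tail D a ≟ v ⌋) →
    PerfectMatching (T ∩ ∁ ⁅ head D a ⁆) c' J → PerfectMatching T c (J ∪ ⁅ a ⁆)
  matching-+arc T c c' J a w∈T c≡c'+δ M = record
    { head∈T     = head∈T'
    ; indegIn≡1  = indegIn≡1'
    ; outdegIn≡c = λ v → begin
        outdegIn (J ∪ ⁅ a ⁆) v                ≡⟨ sum-restrict-∪ J ⁅ a ⁆ J∩a≡∅ ⟩
        outdegIn J v + outdegIn ⁅ a ⁆ v       ≡⟨ cong₂ _+_ (outdegIn≡c v) (sum-restrict-⁅⁆ a) ⟩
        c' v + 𝟙 ⌊ tail D a ≟ v ⌋             ≡⟨ c≡c'+δ v ⟨
        c v                                   ∎
    }
    where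
    open PerfectMatching M
    open ≡-Reasoning
    w = head D a
    J∩a≡∅ : Disjoint J ⁅ a ⁆
    J∩a≡∅ b b∈J with lookup ⁅ a ⁆ b in b∈⁅a⁆
    ... | false = refl
    ... | true with refl ← ∈⁅⁆⇒≡ a b b∈⁅a⁆
      = case trans (sym (head∈T a b∈J)) (∉∩∁ T ⁅ w ⁆ w (i∈⁅i⁆ w)) of λ ()
    head∈T' : ∀ b → lookup (J ∪ ⁅ a ⁆) b ≡ true → lookup T (head D b) ≡ true
    head∈T' b b∈J' rewrite lookup-zipWith _∨_ b J ⁅ a ⁆ with lookup J b in b∈J
    ... | true  = proj₁ (∈∩∁-elim T ⁅ w ⁆ _ (head∈T b b∈J))
    ... | false with refl ← ∈⁅⁆⇒≡ a b b∈J' = w∈T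
    indegIn≡1' : ∀ v → lookup T v ≡ true → indegIn (J ∪ ⁅ a ⁆) v ≡ 1
    indegIn≡1' v v∈T = trans (sum-restrict-∪ J ⁅ a ⁆ J∩a≡∅)
      (trans (cong (indegIn J v +_) (sum-restrict-⁅⁆ a)) (split (w ≟ v)))
      where
      split : (w≟v : Dec (w ≡ v)) → indegIn J v + 𝟙 ⌊ w≟v ⌋ ≡ 1
      split (yes refl) = cong (_+ 1) (indegIn-outside w M (∉∩∁ T ⁅ w ⁆ w (i∈⁅i⁆ w)))
      split (no w≢v)   = trans (ℕ.+-identityʳ _) (indegIn≡1 v (∈∩∁-intro T ⁅ w ⁆ v v∈T
                           (trans (lookup-⁅⁆ w v) (⌊⌋-false (w ≟ v) w≢v))))

  hall-decrement : ∀ T c w u → StrictHallCondition T c → lookup T w ≡ true → 0 < c u →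
    HallCondition (T ∩ ∁ ⁅ w ⁆) (decrement u c)
  hall-decrement T c w u strict-hall w∈T 0<cᵤ Y Y⊆T' with nonEmpty? Y
  ... | no Y≡∅ = ℕ.≤-trans (ℕ.≤-reflexive (size-empty Y Y≡∅)) z≤n
  ... | yes Y≢∅ = ℕ.≤-pred (begin
    suc (size Y)                                           ≤⟨ strict-hall Y Y⊆T Y≢∅ (w , w∈T∖Y) ⟩
    cap c Y                                                ≤⟨ sum-mono-≤ cap-bound ⟩
    sum (λ v → restrict (N⁻ Y) (decrement u c) v + 𝟙 ⌊ u ≟ v ⌋)
      ≡⟨ ∑-distrib-+ (restrict (N⁻ Y) (decrement u c)) (λ v → 𝟙 ⌊ u ≟ v ⌋) ⟩
    cap (decrement u c) Y + sum (λ v → 𝟙 ⌊ u ≟ v ⌋)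
      ≡⟨ trans (cong (cap (decrement u c) Y +_) (sum-𝟙≟ u)) (ℕ.+-comm _ 1) ⟩
    suc (cap (decrement u c) Y)                            ∎)
    where
    open ℕ.≤-Reasoning
    Y⊆T : Y ⊆ T
    Y⊆T i i∈Y = proj₁ (∈∩∁-elim T ⁅ w ⁆ i (Y⊆T' i i∈Y))
    w∈T∖Y : lookup (T ∩ ∁ Y) w ≡ true
    w∈T∖Y with lookup Y w in w∈Y
    ... | false = ∈∩∁-intro T Y w w∈T w∈Y
    ... | true  = case trans (sym (Y⊆T' w w∈Y)) (∉∩∁ T ⁅ w ⁆ w (i∈⁅i⁆ w)) of λ ()
    cap-bound : ∀ v → restrict (N⁻ Y) c v ≤ restrict (N⁻ Y) (decrement u c) v + 𝟙 ⌊ u ≟ v ⌋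
    cap-bound v with lookup (N⁻ Y) v
    ... | true  = ℕ.≤-reflexive (decrement-+ c u 0<cᵤ v)
    ... | false = z≤n

  matching-through : ∀ T c → SolvableBelow T → StrictHallCondition T c → sum c ≡ size T →
    ∀ a → lookup T (head D a) ≡ true → 0 < c (tail D a) →
    ∃ λ J → lookup J a ≡ true × PerfectMatching T c J
  matching-through T c solvable< strict-hall Σc≡size a w∈T 0<cᵤ =
    let J , M = solvable< T' size-T'<size-T (decrement u c) (hall-decrement T c w u strict-hall w∈T 0<cᵤ) Σc'
    in  J ∪ ⁅ a ⁆ , i∈X∪⁅i⁆ J a , matching-+arc T c (decrement u c) J a w∈T (decrement-+ c u 0<cᵤ) M
    where
    w = head D a
    u = tail D a
    T' = T ∩ ∁ ⁅ w ⁆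
    size-T'<size-T : size T' < size T
    size-T'<size-T = ℕ.≤-reflexive (trans (ℕ.+-comm 1 (size T')) (sym (size-remove T w w∈T)))
    Σc' : sum (decrement u c) ≡ size T'
    Σc' = ℕ.+-cancelʳ-≡ 1 (sum (decrement u c)) (size T')
            (trans (sym (sum-decrement c u 0<cᵤ)) (trans Σc≡size (size-remove T w w∈T)))

  arc-into : ∀ T c → HallCondition T c → ∀ w → lookup T w ≡ true → ∃ λ a → head D a ≡ w × 0 < c (tail D a)
  arc-into T c hall w w∈T
    with sum-positive (restrict (N⁻ ⁅ w ⁆) c) (subst (_≤ cap c ⁅ w ⁆) (sum-restrict-⁅⁆ w) (hall ⁅ w ⁆ (⁅⁆⊆ T w w∈T)))
  ... | u , 0<cᵤ with lookup (N⁻ ⁅ w ⁆) u in u∈N⁻w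
  ...   | true with N⁻-elim ⁅ w ⁆ u u∈N⁻w
  ...     | a , refl , a→w = a , sym (∈⁅⁆⇒≡ w (head D a) a→w) , 0<cᵤ

  solvable-step : ∀ T → SolvableBelow T → Solvable T
  solvable-step T solvable< c hall Σc≡size with strict-or-tight T c
  ... | inj₂ (X , tight) = split-at-tight T c X solvable< tight hall Σc≡size
  ... | inj₁ strict with nonEmpty? T
  ...   | no T≡∅ = ∅ , empty-matching T c T≡∅ Σc≡size
  ...   | yes (w , w∈T) with arc-into T c hall w w∈T
  ...     | a , refl , 0<cᵤ =
    let J , _ , M = matching-through T c solvable< strict Σc≡size a w∈T 0<cᵤ in J , M

  solvable : ∀ T → Solvable T
  solvable T = solvable-acc T (<-wellFounded (size T))
    where
    solvable-acc : ∀ T → Acc _<_ (size T) → Solvable T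
    solvable-acc T (acc smaller) = solvable-step T λ T' size-T'<size-T → solvable-acc T' (smaller size-T'<size-T)

-- Sources and sinks

module DigraphFacts {n m : ℕ} (D : Digraph n m) where

  open HallTheorem D using (N⁻; N⁻-elim)

  sink⇒no-tail : ∀ {v} → IsSink D v → ∀ a → tail D a ≢ v
  sink⇒no-tail v-sink a tail≡v =
    case trans (sym (⌊⌋-intro (tail D a ≟ _) tail≡v)) (count≡0⇒false _ (ℕ.≡ᵇ⇒≡ _ 0 (Equivalence.from T-≡ v-sink)) a) of λ ()

  source⇒no-head : ∀ {v} → IsSource D v → ∀ a → head D a ≢ v
  source⇒no-head v-source a head≡v =
    case trans (sym (⌊⌋-intro (head D a ≟ _) head≡v)) (count≡0⇒false _ (ℕ.≡ᵇ⇒≡ _ 0 (Equivalence.from T-≡ v-source)) a) of λ ()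

  tail-not-sink : ∀ a → sinkB D (tail D a) ≡ false
  tail-not-sink a with sinkB D (tail D a) in tail-sink?
  ... | false = refl
  ... | true  = ⊥-elim (sink⇒no-tail tail-sink? a refl)

  N⁻-not-sink : ∀ X u → lookup (N⁻ X) u ≡ true → sinkB D u ≡ false
  N⁻-not-sink X u u∈N⁻X with N⁻-elim X u u∈N⁻X
  ... | a , refl , _ = tail-not-sink a

  sink∉N⁻ : ∀ X v → IsSink D v → lookup (N⁻ X) v ≡ false
  sink∉N⁻ X v v-sink with lookup (N⁻ X) v in v∈N⁻X
  ... | false = refl
  ... | true  = case trans (sym v-sink) (N⁻-not-sink X v v∈N⁻X) of λ ()

  not-sink⇒out-arc : ∀ u → sinkB D u ≡ false → ∃ λ a → tail D a ≡ u
  not-sink⇒out-arc u u-not-sink =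
    let a , tail≡u = count-positive⇒∃ _ (ℕ.n≢0⇒n>0 λ outdeg≡0 →
                       case trans (sym u-not-sink) (cong (ℕ._≡ᵇ 0) outdeg≡0) of λ ())
    in  a , ⌊⌋-true (tail D a ≟ u) tail≡u

module DigraftFacts {n m : ℕ} {D : Digraph n m} {𝓕 : Subset n → Set} (digraft : Digraft D 𝓕) where

  open Digraft digraft
  open DigraphFacts D
  open HallTheorem D using (N⁻; N⁻-intro)

  head-sink : ∀ a → IsSink D (head D a)
  head-sink a with bipartite (head D a)
  ... | inj₁ head-source = ⊥-elim (source⇒no-head head-source a refl)
  ... | inj₂ head-sink   = head-sink

  not-sink⇒source : ∀ v → sinkB D v ≡ false → IsSource D v
  not-sink⇒source v v-not-sink with bipartite v
  ... | inj₁ v-source = v-source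
  ... | inj₂ v-sink   = case trans (sym v-sink) v-not-sink of λ ()

  ⁅⁆≢Vall : (v : Fin n) → ⁅ v ⁆ ≢ Vall
  ⁅⁆≢Vall v ⁅v⁆≡V with sinkB D v in v-sink?
  ... | true  = noEmpty (subst 𝓕 (trans (cong ∁ ⁅v⁆≡V) (map-replicate not true n)) (sinkCompl v v-sink?))
  ... | false =
    let a , _ = not-sink⇒out-arc v v-sink?
        v≡head = ∈⁅⁆⇒≡ v (head D a) (trans (cong (λ W → lookup W (head D a)) ⁅v⁆≡V) (lookup-replicate (head D a) true))
    in  case trans (sym (head-sink a)) (trans (cong (sinkB D) (sym v≡head)) v-sink?) of λ ()

  sink⇒not-source : ∀ v → IsSink D v → sourceB D v ≡ false
  sink⇒not-source v v-sink with sourceB D v in v-source?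
  ... | false = refl
  ... | true  = case ℕ.≤-trans (twoEC ⁅ v ⁆ (⁅⁆≢∅ v) (⁅⁆≢Vall v)) (ℕ.≤-reflexive (count-false _ isolated)) of λ ()
    where
    isolated : ∀ a → (leaves D ⁅ v ⁆ a ∨ enters D ⁅ v ⁆ a) ≡ false
    isolated a rewrite ∉⁅⁆ (sink⇒no-tail v-sink a ∘ sym) | ∉⁅⁆ (source⇒no-head v-source? a ∘ sym) = refl

  ⁅⁆∈U : ∀ v → sinkB D v ≡ false → InU D ⁅ v ⁆
  ⁅⁆∈U v v-not-sink = ⁅⁆≢∅ v , ⁅⁆≢Vall v , no-entering
    where
    no-entering : NoEntering D ⁅ v ⁆
    no-entering a rewrite ∉⁅⁆ {i = v} {head D a} λ { refl → case trans (sym (head-sink a)) v-not-sink of λ () } = refl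

  sinks : Subset n
  sinks = tabulate (sinkB D)

  sinks-sink : ∀ v → lookup sinks v ≡ sinkB D v
  sinks-sink = lookup∘tabulate (sinkB D)

  head∈sinks : ∀ a → lookup sinks (head D a) ≡ true
  head∈sinks a = trans (sinks-sink (head D a)) (head-sink a)

  ∈sinks⇒sink : ∀ X → X ⊆ sinks → ∀ v → lookup X v ≡ true → IsSink D v
  ∈sinks⇒sink X X⊆sinks v v∈X = trans (sym (sinks-sink v)) (X⊆sinks v v∈X)

  X∪N⁻X∈U : ∀ X → X ⊆ sinks → NonEmpty X → NonEmpty (sinks ∩ ∁ X) → InU D (X ∪ N⁻ X)
  X∪N⁻X∈U X X⊆sinks (x , x∈X) (y , y∈sinks∖X) = W≢∅ , W≢Vall , no-entering
    where
    W = X ∪ N⁻ X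
    W≢∅ : W ≢ ∅
    W≢∅ W≡∅ = case trans (sym x∈W) (trans (cong (λ S → lookup S x) W≡∅) (∉∅ x)) of λ ()
      where
      x∈W : lookup W x ≡ true
      x∈W = trans (lookup-zipWith _∨_ x X (N⁻ X)) (cong (_∨ lookup (N⁻ X) x) x∈X)
    W≢Vall : W ≢ Vall
    W≢Vall W≡V = case trans (sym y∉W) (trans (cong (λ S → lookup S y) W≡V) (lookup-replicate y true)) of λ ()
      where
      y∈sinks = ∈∩∁-elim sinks X y y∈sinks∖X
      y∉W : lookup W y ≡ false
      y∉W rewrite lookup-zipWith _∨_ y X (N⁻ X) | proj₂ y∈sinks
        = sink∉N⁻ X y (trans (sym (sinks-sink y)) (proj₁ y∈sinks))
    no-entering : NoEntering D W
    no-entering a with lookup X (head D a) in head∈X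
    ... | true  rewrite lookup-zipWith _∨_ (tail D a) X (N⁻ X) | N⁻-intro X a head∈X
                      | ∨-zeroʳ (lookup X (tail D a)) = ∧-zeroʳ _
    ... | false rewrite lookup-zipWith _∨_ (head D a) X (N⁻ X) | head∈X
                      | sink∉N⁻ X (head D a) (head-sink a) = refl

-- The capacities of a digraft

sumℤ≡sum : (f : Vector ℤ k) → sumℤ f ≡ ℤΣ.sum f
sumℤ≡sum {zero}  f = refl
sumℤ≡sum {suc k} f = cong (ℤ._+_ (f zero)) (sumℤ≡sum (f ∘ suc))

sum-+ : (f : Vector ℕ k) → ℤΣ.sum (λ i → ℤ.+ f i) ≡ ℤ.+ sum f
sum-+ {zero}  f = refl
sum-+ {suc k} f = trans (cong (ℤ._+_ (ℤ.+ f zero)) (sum-+ (f ∘ suc))) (sym (ℤ.pos-+ (f zero) (sum (f ∘ suc))))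

sum-restrict-+ : (X : Subset k) (f : Vector ℕ k) → ℤΣ.sum (ℤΣ.restrict X (λ i → ℤ.+ f i)) ≡ ℤ.+ sum (restrict X f)
sum-restrict-+ X f = trans (ℤΣ.sum-cong-≗ pointwise) (sum-+ (restrict X f))
  where
  pointwise : ∀ i → ℤΣ.restrict X (λ i → ℤ.+ f i) i ≡ ℤ.+ restrict X f i
  pointwise i with lookup X i
  ... | true  = refl
  ... | false = refl

cancel-disc-≤ : ∀ (s r C : ℕ) (Z : ℤ) →
  ℤ.+ 1 ℤ.+ (ℤ.+ s ℤ.- ℤ.+ r) ℤ.≤ Z → Z ℤ.+ ℤ.+ r ≡ ℤ.+ C → suc s ≤ C
cancel-disc-≤ s r C Z 1+s-r≤Z Z+r≡C = ℤ.drop‿+≤+ (begin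
  ℤ.+ 1 ℤ.+ ℤ.+ s                         ≡⟨ shift (ℤ.+ s) (ℤ.+ r) ⟩
  ℤ.+ 1 ℤ.+ (ℤ.+ s ℤ.- ℤ.+ r) ℤ.+ ℤ.+ r   ≤⟨ ℤ.+-monoˡ-≤ (ℤ.+ r) 1+s-r≤Z ⟩
  Z ℤ.+ ℤ.+ r                             ≡⟨ Z+r≡C ⟩
  ℤ.+ C                                   ∎)
  where
  open ℤ.≤-Reasoning
  shift : ∀ (i j : ℤ) → ℤ.+ 1 ℤ.+ i ≡ ℤ.+ 1 ℤ.+ (i ℤ.- j) ℤ.+ j
  shift = solve-∀

cancel-disc-≡ : ∀ (s r C : ℕ) (Z : ℤ) → Z ≡ ℤ.+ s ℤ.- ℤ.+ r → Z ℤ.+ ℤ.+ r ≡ ℤ.+ C → C ≡ s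
cancel-disc-≡ s r C Z Z≡s-r Z+r≡C = ℤ.+-injective (begin
  ℤ.+ C                           ≡⟨ Z+r≡C ⟨
  Z ℤ.+ ℤ.+ r                     ≡⟨ cong (ℤ._+ ℤ.+ r) Z≡s-r ⟩
  ℤ.+ s ℤ.- ℤ.+ r ℤ.+ ℤ.+ r       ≡⟨ shift (ℤ.+ s) (ℤ.+ r) ⟨
  ℤ.+ s                           ∎)
  where
  open ≡-Reasoning
  shift : ∀ (i j : ℤ) → i ≡ i ℤ.- j ℤ.+ j
  shift = solve-∀

module Capacities {n m : ℕ} {D : Digraph n m} {𝓕 : Subset n → Set} (digraft : Digraft D 𝓕)
                  (z : Fin n → ℤ) (z∈P : InPF D 𝓕 z) where

  open import Data.Integer using (+_; ∣_∣)
  open HallTheorem D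
  open DigraphFacts D
  open DigraftFacts digraft

  z≥1+disc : ∀ W → InU D W → + 1 ℤ.+ disc D W ℤ.≤ zSum D z W
  z≥1+disc = proj₁ (proj₁ z∈P)

  zV≡discV : zSum D z Vall ≡ disc D Vall
  zV≡discV = proj₂ (proj₁ z∈P)

  z-sink : ∀ v → IsSink D v → z v ≡ + 0
  z-sink = proj₁ (proj₂ z∈P)

  -- suc ∣ z v ∣ is z v + 1 only because z v ≥ 0 off the sinks (z-nonneg).
  c : Vector ℕ n
  c v = if sinkB D v then 0 else suc ∣ z v ∣

  zSum≡sum : ∀ W → zSum D z W ≡ ℤΣ.sum (ℤΣ.restrict W z)
  zSum≡sum W = sumℤ≡sum (ℤΣ.restrict W z)

  zSum-⁅⁆ : ∀ v → zSum D z ⁅ v ⁆ ≡ z v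
  zSum-⁅⁆ v = trans (zSum≡sum ⁅ v ⁆) (ℤΣ.sum-restrict-⁅⁆ v)

  z-nonneg : ∀ v → sinkB D v ≡ false → + 0 ℤ.≤ z v
  z-nonneg v v-not-sink = subst₂ ℤ._≤_ 1+disc≡0 (zSum-⁅⁆ v) (z≥1+disc ⁅ v ⁆ (⁅⁆∈U v v-not-sink))
    where
    1+disc≡0 : + 1 ℤ.+ disc D ⁅ v ⁆ ≡ + 0
    1+disc≡0 rewrite count-⁅⁆ v (sinkB D) | count-⁅⁆ v (sourceB D) | v-not-sink | not-sink⇒source v v-not-sink = refl

  z+source≡c : ∀ v → z v ℤ.+ + 𝟙 (sourceB D v) ≡ + c v
  z+source≡c v with sinkB D v in v-sink?
  ... | true  rewrite z-sink v v-sink? | sink⇒not-source v v-sink? = refl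
  ... | false rewrite not-sink⇒source v v-sink? = begin
    z v ℤ.+ + 1              ≡⟨ cong (ℤ._+ + 1) (ℤ.0≤i⇒+∣i∣≡i (z-nonneg v v-sink?)) ⟨
    (+ ∣ z v ∣) ℤ.+ (+ 1)    ≡⟨ ℤ.pos-+ (∣ z v ∣) 1 ⟨
    + (∣ z v ∣ + 1)          ≡⟨ cong +_ (ℕ.+-comm (∣ z v ∣) 1) ⟩
    + suc (∣ z v ∣)          ∎
    where open ≡-Reasoning

  surplus : ∀ W → zSum D z W ℤ.+ + count (λ v → lookup W v ∧ sourceB D v) ≡ + sum (restrict W c)
  surplus W = begin
    zSum D z W ℤ.+ + count (λ v → lookup W v ∧ sourceB D v)
      ≡⟨ cong₂ ℤ._+_ (zSum≡sum W) (trans (cong +_ (count-∧ W (sourceB D))) (sym (sum-restrict-+ W (𝟙 ∘ sourceB D)))) ⟩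
    ℤΣ.sum (ℤΣ.restrict W z) ℤ.+ ℤΣ.sum (ℤΣ.restrict W (+_ ∘ 𝟙 ∘ sourceB D))
      ≡⟨ ℤΣ.∑-distrib-+ (ℤΣ.restrict W z) (ℤΣ.restrict W (+_ ∘ 𝟙 ∘ sourceB D)) ⟨
    ℤΣ.sum (λ v → ℤΣ.restrict W z v ℤ.+ ℤΣ.restrict W (+_ ∘ 𝟙 ∘ sourceB D) v)
      ≡⟨ ℤΣ.sum-cong-≗ pointwise ⟩
    ℤΣ.sum (ℤΣ.restrict W (+_ ∘ c))
      ≡⟨ sum-restrict-+ W c ⟩
    + sum (restrict W c) ∎
    where
    open ≡-Reasoning
    pointwise : ∀ v → ℤΣ.restrict W z v ℤ.+ ℤΣ.restrict W (+_ ∘ 𝟙 ∘ sourceB D) v ≡ ℤΣ.restrict W (+_ ∘ c) v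
    pointwise v with lookup W v
    ... | true  = z+source≡c v
    ... | false = refl

  c-sink : ∀ v → IsSink D v → c v ≡ 0
  c-sink v v-sink = cong (λ b → if b then 0 else suc ∣ z v ∣) v-sink

  Σc≡size : sum c ≡ size sinks
  Σc≡size = begin
    sum c                                          ≡⟨ sum-restrict-Vall c ⟨
    sum (restrict Vall c)                          ≡⟨ cancel-disc-≡ _ _ _ _ zV≡discV (surplus Vall) ⟩
    count (λ v → lookup Vall v ∧ sinkB D v)        ≡⟨ count-∧ Vall (sinkB D) ⟩
    sum (restrict Vall (𝟙 ∘ sinkB D))              ≡⟨ sum-cong-≗ pointwise ⟩
    size sinks                                     ∎
    where
    open ≡-Reasoning
    pointwise : ∀ v → restrict Vall (𝟙 ∘ sinkB D) v ≡ restrict sinks (λ _ → 1) v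
    pointwise v rewrite lookup-replicate v true | sinks-sink v = refl

  strict-hall : StrictHallCondition sinks c
  strict-hall X X⊆sinks X≢∅ sinks⊈X =
    subst₂ _≤_ (cong suc sinks-in-W) c-on-W
      (cancel-disc-≤ _ _ _ _ (z≥1+disc W (X∪N⁻X∈U X X⊆sinks X≢∅ sinks⊈X)) (surplus W))
    where
    W = X ∪ N⁻ X
    X∩N⁻X≡∅ : Disjoint X (N⁻ X)
    X∩N⁻X≡∅ v v∈X = sink∉N⁻ X v (∈sinks⇒sink X X⊆sinks v v∈X)
    sinks-in-W : count (λ v → lookup W v ∧ sinkB D v) ≡ size X
    sinks-in-W = begin
      count (λ v → lookup W v ∧ sinkB D v)                                 ≡⟨ count-∧ W (sinkB D) ⟩
      sum (restrict W (𝟙 ∘ sinkB D))                                       ≡⟨ sum-restrict-∪ X (N⁻ X) X∩N⁻X≡∅ ⟩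
      sum (restrict X (𝟙 ∘ sinkB D)) + sum (restrict (N⁻ X) (𝟙 ∘ sinkB D))
        ≡⟨ cong₂ _+_ (sum-restrict-cong X λ v v∈X → cong 𝟙 (∈sinks⇒sink X X⊆sinks v v∈X))
                     (sum-restrict-0 (N⁻ X) λ v v∈N⁻X → cong 𝟙 (N⁻-not-sink X v v∈N⁻X)) ⟩
      size X + 0                                                           ≡⟨ ℕ.+-identityʳ (size X) ⟩
      size X                                                               ∎
      where open ≡-Reasoning
    c-on-W : sum (restrict W c) ≡ cap c X
    c-on-W = trans (sum-restrict-∪ X (N⁻ X) X∩N⁻X≡∅)
                   (cong (_+ cap c X) (sum-restrict-0 X λ v v∈X → c-sink v (∈sinks⇒sink X X⊆sinks v v∈X)))

  size≤cap : size sinks ≤ cap c sinks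
  size≤cap = ℕ.≤-trans (ℕ.≤-reflexive (sym Σc≡size)) (sum-mono-≤ pointwise)
    where
    pointwise : ∀ v → c v ≤ restrict (N⁻ sinks) c v
    pointwise v with sinkB D v in v-sink?
    ... | true  = z≤n
    ... | false with not-sink⇒out-arc v v-sink?
    ...   | a , refl rewrite N⁻-intro sinks a (head∈sinks a) = ℕ.≤-refl

  hall : HallCondition sinks c
  hall = strict⇒hall sinks c strict-hall size≤cap

  0<c-tail : ∀ a → 0 < c (tail D a)
  0<c-tail a rewrite tail-not-sink a = s≤s z≤n

  degree-condition : ∀ {J} → PerfectMatching sinks c J → DegreeCond D z J
  degree-condition {J} M v with sinkB D v in v-sink?
  ... | true = begin
    + count (λ a → lookup J a ∧ incident D v a) ℤ.- + 1
      ≡⟨ cong (λ k → + k ℤ.- + 1) (trans (count-∧ J (incident D v)) (sum-restrict-cong J λ a _ → cong 𝟙 (incident≡head a))) ⟩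
    + indegIn J v ℤ.- + 1
      ≡⟨ cong (λ k → + k ℤ.- + 1) (indegIn≡1 v (trans (sinks-sink v) v-sink?)) ⟩
    + 0
      ≡⟨ z-sink v v-sink? ⟨
    z v ∎
    where
    open ≡-Reasoning
    open PerfectMatching M
    incident≡head : ∀ a → incident D v a ≡ ⌊ head D a ≟ v ⌋
    incident≡head a = cong (_∨ ⌊ head D a ≟ v ⌋) (⌊⌋-false (tail D a ≟ v) (sink⇒no-tail v-sink? a))
  ... | false = begin
    + count (λ a → lookup J a ∧ incident D v a) ℤ.- + 1
      ≡⟨ cong (λ k → + k ℤ.- + 1) (trans (count-∧ J (incident D v)) (sum-restrict-cong J λ a _ → cong 𝟙 (incident≡tail a))) ⟩
    + outdegIn J v ℤ.- + 1
      ≡⟨ cong (λ k → + k ℤ.- + 1) (trans (outdegIn≡c v) (cong (λ b → if b then 0 else suc ∣ z v ∣) v-sink?)) ⟩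
    + ∣ z v ∣
      ≡⟨ ℤ.0≤i⇒+∣i∣≡i (z-nonneg v v-sink?) ⟩
    z v ∎
    where
    open ≡-Reasoning
    open PerfectMatching M
    incident≡tail : ∀ a → incident D v a ≡ ⌊ tail D a ≟ v ⌋
    incident≡tail a = trans (cong (⌊ tail D a ≟ v ⌋ ∨_) (⌊⌋-false (head D a ≟ v) head≢v)) (∨-identityʳ _)
      where
      head≢v : head D a ≢ v
      head≢v refl = case trans (sym (head-sink a)) v-sink? of λ ()

mainTheorem16 : ∀ {n m : ℕ} (D : Digraph n m) (𝓕 : Subset n → Set) →
    Digraft D 𝓕 → (z : Fin n → ℤ) → InPF D 𝓕 z →
    (∃ λ (J : Subset m) → DegreeCond D z J)
    × (∀ (a : Fin m) → ∃ λ (J : Subset m) → lookup J a ≡ true × DegreeCond D z J)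
mainTheorem16 D 𝓕 digraft z z∈P = some-J , J-through
  where
  open HallTheorem D
  open DigraftFacts digraft using (sinks; head∈sinks)
  open Capacities digraft z z∈P

  some-J : ∃ λ J → DegreeCond D z J
  some-J = let J , M = solvable sinks c hall Σc≡size in J , degree-condition M

  J-through : ∀ a → ∃ λ J → lookup J a ≡ true × DegreeCond D z J
  J-through a =
    let J , a∈J , M = matching-through sinks c (λ T _ → solvable T) strict-hall Σc≡size a (head∈sinks a) (0<c-tail a)
    in  J , a∈J , degree-condition M
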